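{- Let $b\ge2$, $s\ge1$, $\mathbf{e}=(e_1,\dots,e_s)\in\mathbb{N}^s$ and $e_0=e_1+\dots+e_s$. If $(\mathbf{x}_n)_{n\ge0}$ is a $(0,\mathbf{e},s)$-sequence in base $b$, then $(\mathbf{x}_n)_{n\ge0}$ is $e_0$-admissible in base $b$, i.e. $\inf_{n>k\ge0}\|n\ominus k\|_b\,\|\mathbf{x}_n\ominus\mathbf{x}_k\|_b\ge b^{ -e_0}$.
   Context: Fix base $b\ge2$, $Z_b=\{0,\dots,b-1\}$. Each $x\in[0,1)$ is identified with its $b$-adic digit sequence $x=\sum_{j\ge1}x_jb^{ -j}$, $x_j\in Z_b$, not ending in infinitely many digits $b-1$; $[x]_m=\sum_{j=1}^mx_jb^{ -j}$, applied coordinatewise on $[0,1)^s$. For $x,y\in[0,1)$, $x\ominus y=\sum_jv_jb^{ -j}$ with $v_j\in Z_b$, $v_j\equiv x_j-y_j\pmod b$, coordinatewise on vectors. Valuation: if $v=\sum_jv_jb^{ -j}$ has $v_1=\dots=v_k=0$, $v_{k+1}\ne0$, then $\|v\|_b=b^{ -k-1}$ ($0$ if all digits vanish); $\|\mathbf{v}\|_b=\prod_{i=1}^s\|v^{(i)}\|_b$. For integers $n>k\ge0$, $n\ominus k$ is the integer whose base-$b$ digits are the digitwise differences mod $b$ of those of $n$ and $k$, and for an integer $N\ge1$ with $b^j\le N<b^{j+1}$, $\|N\|_b=b^j$. A $(0,m,\mathbf{e},s)$-net in base $b$ is a set of $b^m$ points in $[0,1)^s$ such that every box $J=\prod_i[a_ib^{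 -d_i},(a_i+1)b^{ -d_i})$ with integers $d_i\ge0$, $0\le a_i<b^{d_i}$, $e_i\mid d_i$ and $\mathrm{Vol}(J)\ge b^{ -m}$ contains exactly $b^m\mathrm{Vol}(J)$ of the points. A sequence $(\mathbf{x}_n)_{n\ge0}$ in $[0,1)^s$ is a $(0,\mathbf{e},s)$-sequence in base $b$ if for all integers $k\ge0$ and $m>0$ the points $[\mathbf{x}_n]_m$, $kb^m\le n<(k+1)b^m$, form a $(0,m,\mathbf{e},s)$-net in base $b$. A sequence is $d$-admissible in base $b$ if $\inf_{n>k\ge0}\|n\ominus k\|_b\|\mathbf{x}_n\ominus\mathbf{x}_k\|_b\ge b^{ -d}$. -}

module Defs where

open import Data.Nat using (ℕ; zero; suc; _+_; _*_; _∸_; _^_; _≤_; _<_; _≤?_; _<?_; NonZero)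
open import Data.Nat.DivMod using (_/_; _%_)
open import Data.Nat.Divisibility using (_∣_)
open import Data.Nat.Properties using (_≟_)
open import Data.Fin using (Fin; toℕ) renaming (zero to fzero; suc to fsuc)
open import Data.Fin.Properties using (all?)
open import Data.Product using (Σ; ∃; _×_; _,_)
open import Relation.Nullary using (¬_; Dec; yes; no)
open import Relation.Binary.PropositionalEquality using (_≡_; _≢_)

sumF : ∀ {s} → (Fin s → ℕ) → ℕ
sumF {zero}  f = 0
sumF {suc s} f = f fzero + sumF (λ i → f (fsuc i))

-- Digit sequences: a digit function x : ℕ → Fin b, where  x j  is the
-- (j+1)-st b-adic digit x_{j+1} of the represented number in [0,1).
Digits : ℕ → Set
Digits b = ℕ → Fin b

-- Admissible representation of a point of [0,1): not ending in
-- infinitely many digits b-1 (i.e. infinitely many digits differ from b-1).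
Point : ℕ → Set
Point b = Σ (Digits b) λ x → ∀ N → ∃ λ j → N ≤ j × toℕ (x j) ≢ b ∸ 1

digitsOf : ∀ {b} → Point b → Digits b
digitsOf (x , _) = x

PointS : ℕ → ℕ → Set
PointS b s = Fin s → Point b

Seq : ℕ → ℕ → Set
Seq b s = ℕ → PointS b s

truncDig : ∀ {b} → ℕ → Point b → ℕ → ℕ
truncDig m x j with j <? m
... | yes _ = toℕ (digitsOf x j)
... | no  _ = 0

-- Integer formed by the first d digits: Σ_{j=1}^d v_j b^{d-j} = ⌊ v b^d ⌋.
prefixVal : ℕ → (ℕ → ℕ) → ℕ → ℕ
prefixVal b v zero    = 0
prefixVal b v (suc d) = prefixVal b v d * b + v d

-- v lies in the elementary interval [a b^{-d}, (a+1) b^{-d}).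
InInterval : ℕ → (ℕ → ℕ) → ℕ → ℕ → Set
InInterval b v d a = prefixVal b v d ≡ a

InBox : ∀ {b s} → ℕ → PointS b s → (Fin s → ℕ) → (Fin s → ℕ) → Set
InBox {b} m x d a = ∀ i → InInterval b (truncDig m (x i)) (d i) (a i)

inBox? : ∀ {b s} m (x : PointS b s) d a → Dec (InBox m x d a)
inBox? {b} m x d a = all? (λ i → prefixVal b (truncDig m (x i)) (d i) ≟ a i)

count : {P : ℕ → Set} → ((n : ℕ) → Dec (P n)) → ℕ → ℕ → ℕ
count P? start zero = 0
count P? start (suc len) with P? start
... | yes _ = suc (count P? (suc start) len)
... | no  _ = count P? (suc start) len

-- (0, e, s)-sequence in base b: for all k ≥ 0, m > 0, the points [x_n]_m,
-- k b^m ≤ n < (k+1) b^m, form a (0,m,e,s)-net: every box with e_i | d_i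
-- and volume b^{-Σ d_i} ≥ b^{-m} contains exactly b^{m - Σ d_i} of them.
Is0eSeq : ∀ {s} (b : ℕ) → (Fin s → ℕ) → Seq b s → Set
Is0eSeq {s} b e x =
  ∀ (k m : ℕ) → 0 < m →
  ∀ (d a : Fin s → ℕ) →
  (∀ i → e i ∣ d i) → (∀ i → a i < b ^ d i) → sumF d ≤ m →
  count (λ n → inBox? m (x n) d a) (k * b ^ m) (b ^ m) ≡ b ^ (m ∸ sumF d)

-- Digits of the digitwise difference n ⊖ k of two natural numbers
-- (fuel = number of digits processed; n digits suffice for n).
ominusFuel : (b : ℕ) → .{{NonZero b}} → ℕ → ℕ → ℕ → ℕ
ominusFuel b zero    n k = 0
ominusFuel b (suc f) n k =
  ((n % b) + (b ∸ (k % b))) % b + b * ominusFuel b f (n / b) (k / b)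

ominusℕ : (b : ℕ) → .{{NonZero b}} → ℕ → ℕ → ℕ
ominusℕ b n k = ominusFuel b n n k

-- Digits (as naturals, 0-indexed: index j is digit j+1) of x ⊖ y.
ominusDig : ∀ {b} → .{{NonZero b}} → Point b → Point b → ℕ → ℕ
ominusDig {b} x y j = (toℕ (digitsOf x j) + (b ∸ toℕ (digitsOf y j))) % b

-- NormExp v t  :⇔  ‖v‖_b = b^{-t}  (v ≠ 0, first nonzero digit is v_t).
NormExp : (ℕ → ℕ) → ℕ → Set
NormExp v t = Σ ℕ λ r → t ≡ suc r × (∀ j → j < r → v j ≡ 0) × v r ≢ 0

-- d-admissible: for all n > k ≥ 0,
--   ‖n ⊖ k‖_b · Π_i ‖x_n^{(i)} ⊖ x_k^{(i)}‖_b ≥ b^{-D}.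
-- With ‖n ⊖ k‖_b = b^j (b^j ≤ n⊖k < b^{j+1}) and ‖·‖_b ∈ {0} ∪ {b^{-t}},
-- this says: every coordinate difference is nonzero, with exponents t_i,
-- and j - Σ t_i ≥ -D, i.e. Σ t_i ≤ D + j.
Admissible : ∀ {s} (b : ℕ) → .{{NonZero b}} → ℕ → Seq b s → Set
Admissible {s} b D x =
  ∀ (n k : ℕ) → k < n →
  ∀ (j : ℕ) → b ^ j ≤ ominusℕ b n k → ominusℕ b n k < b ^ suc j →
  Σ (Fin s → ℕ) λ t →
    (∀ i → NormExp (ominusDig (x n i) (x k i)) (t i)) × sumF t ≤ D + j

-- Let n > k with ‖n ⊖ k‖_b = b^j, so n and k lie in a common block of b^m
-- consecutive indices for every m > j.  If the digit differences of x_n and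
-- x_k vanished on the first d_i digits of each coordinate, with e_i ∣ d_i and
-- Σ d_i = m > j, then [x_n]_m and [x_k]_m would share a box of volume b^{-m},
-- which in a (0,e,s)-sequence holds exactly one point of the block.  Taking
-- d_i = e_i (j+1) in one coordinate shows every difference is nonzero; taking
-- d_i = e_i ⌊r_i / e_i⌋, where r_i + 1 is the position of the first nonzero
-- digit, gives Σ d_i ≤ j and hence Σ (r_i + 1) ≤ Σ (d_i + e_i) ≤ e_0 + j.
module Submission where

open import Defs
open import Data.Nat.Base
open import Data.Nat.Properties
open import Data.Nat.DivMod
open import Data.Nat.Divisibility using (_∣_; _∣0; n∣m*n; m∣m*n)
open import Data.Fin using (Fin; toℕ) renaming (zero to fzero; suc to fsuc)
open import Data.Fin.Properties using (toℕ<n) renaming (_≟_ to _≟F_)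
open import Data.Product using (∃; _×_; _,_; proj₁; proj₂)
open import Data.Sum using (inj₁; inj₂; [_,_]′)
open import Data.Empty using (⊥; ⊥-elim)
open import Relation.Nullary using (¬_; Dec; yes; no)
open import Relation.Binary.PropositionalEquality
open import Algebra.Properties.CommutativeSemigroup +-commutativeSemigroup using (interchange)

sumF-+ : ∀ {s} (f g : Fin s → ℕ) → sumF (λ i → f i + g i) ≡ sumF f + sumF g
sumF-+ {zero}  f g = refl
sumF-+ {suc s} f g =
  trans (cong (f fzero + g fzero +_) (sumF-+ (λ i → f (fsuc i)) (λ i → g (fsuc i))))
        (interchange (f fzero) (g fzero) _ _)

sumF-mono-≤ : ∀ {s} {f g : Fin s → ℕ} → (∀ i → f i ≤ g i) → sumF f ≤ sumF g
sumF-mono-≤ {zero}  f≤g = z≤n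
sumF-mono-≤ {suc s} f≤g = +-mono-≤ (f≤g fzero) (sumF-mono-≤ (λ i → f≤g (fsuc i)))

≤-sumF : ∀ {s} (f : Fin s → ℕ) i → f i ≤ sumF f
≤-sumF f fzero    = m≤m+n _ _
≤-sumF f (fsuc i) = ≤-trans (≤-sumF (λ i → f (fsuc i)) i) (m≤n+m _ _)

single : ∀ {s} → Fin s → ℕ → Fin s → ℕ
single i c i′ with i′ ≟F i
... | yes _ = c
... | no  _ = 0

single-≡ : ∀ {s} (i : Fin s) c → single i c i ≡ c
single-≡ i c with i ≟F i
... | yes _  = refl
... | no i≢i = ⊥-elim (i≢i refl)

module _ {P : ℕ → Set} (P? : (n : ℕ) → Dec (P n)) where

  private
    shift : ∀ {n} start len → n < start + suc len → n < suc start + len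
    shift {n} start len = subst (n <_) (+-suc start len)

    empty : ∀ {start n} → start ≤ n → n < start + 0 → ⊥
    empty {start} start≤n n< = ≤⇒≯ start≤n (subst (_ <_) (+-identityʳ start) n<)

  count-pos : ∀ {start n} len → start ≤ n → n < start + len → P n →
              0 < count P? start len
  count-pos zero start≤n n< _ = ⊥-elim (empty start≤n n<)
  count-pos {start} (suc len) start≤n n< Pn with P? start
  ... | yes _ = z<s
  ... | no ¬P with m≤n⇒m<n∨m≡n start≤n
  ...   | inj₁ start<n = count-pos len start<n (shift start len n<) Pn
  ...   | inj₂ refl    = ⊥-elim (¬P Pn)

  count-≥2 : ∀ {start k n} len → start ≤ k → k < n → n < start + len → P k → P n →
             2 ≤ count P? start len
  count-≥2 zero start≤k k<n n< _ _ = ⊥-elim (empty (≤-trans start≤k (<⇒≤ k<n)) n<)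
  count-≥2 {start} (suc len) start≤k k<n n< Pk Pn with P? start
  ... | yes _ = s≤s (count-pos len (≤-trans (s≤s start≤k) k<n) (shift start len n<) Pn)
  ... | no ¬P with m≤n⇒m<n∨m≡n start≤k
  ...   | inj₁ start<k = count-≥2 len start<k k<n (shift start len n<) Pk Pn
  ...   | inj₂ refl    = ⊥-elim (¬P Pk)

FirstNonzero : (ℕ → ℕ) → ℕ → Set
FirstNonzero v r = (∀ j → j < r → v j ≡ 0) × v r ≢ 0

firstNonzero : ∀ v B → ¬ (∀ r → r < B → v r ≡ 0) → ∃ (FirstNonzero v)
firstNonzero v zero    ¬zero = ⊥-elim (¬zero (λ _ ()))
firstNonzero v (suc B) ¬zero with allUpTo? (λ r → v r ≟ 0) B
... | no ¬zeroB = firstNonzero v B (λ zeroB → ¬zeroB (zeroB _))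
... | yes zeroB = B , (λ _ → zeroB) , λ vB≡0 → ¬zero λ r r<1+B →
  [ zeroB , (λ { refl → vB≡0 }) ]′ (m<1+n⇒m<n∨m≡n r<1+B)

m/n*n≤m<m/n*n+n : ∀ m n .{{_ : NonZero n}} → m / n * n ≤ m × m < m / n * n + n
m/n*n≤m<m/n*n+n m n = m/n*n≤m m n , (begin-strict
  m                 ≡⟨ m≡m%n+[m/n]*n m n ⟩
  m % n + m / n * n <⟨ +-monoˡ-< (m / n * n) (m%n<n m n) ⟩
  n + m / n * n     ≡⟨ +-comm n (m / n * n) ⟩
  m / n * n + n     ∎)
  where open ≤-Reasoning

module Radix (b : ℕ) .{{_ : NonZero b}} where

  _/b^_ : ℕ → ℕ → ℕ
  n /b^ p = _/_ n (b ^ p) {{m^n≢0 b p}}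

  digitDiff≡0⇒≡ : ∀ {a c} → a < b → c < b → (a + (b ∸ c)) % b ≡ 0 → a ≡ c
  digitDiff≡0⇒≡ {a} {c} a<b c<b diff≡0 with c ≤? a
  ... | yes c≤a = ≤-antisym (m∸n≡0⇒m≤n a∸c≡0) c≤a
    where
    wrap : a + (b ∸ c) ≡ (a ∸ c) + b
    wrap = begin
      a + (b ∸ c)           ≡⟨ cong (_+ (b ∸ c)) (m∸n+n≡m c≤a) ⟨
      (a ∸ c + c) + (b ∸ c) ≡⟨ +-assoc (a ∸ c) c (b ∸ c) ⟩
      (a ∸ c) + (c + (b ∸ c)) ≡⟨ cong ((a ∸ c) +_) (m+[n∸m]≡n (<⇒≤ c<b)) ⟩
      (a ∸ c) + b           ∎
      where open ≡-Reasoning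
    a∸c≡0 : a ∸ c ≡ 0
    a∸c≡0 = begin
      a ∸ c             ≡⟨ m<n⇒m%n≡m (≤-<-trans (m∸n≤m a c) a<b) ⟨
      (a ∸ c) % b       ≡⟨ [m+n]%n≡m%n (a ∸ c) b ⟨
      ((a ∸ c) + b) % b ≡⟨ cong (_% b) wrap ⟨
      (a + (b ∸ c)) % b ≡⟨ diff≡0 ⟩
      0                 ∎
      where open ≡-Reasoning
  ... | no c≰a = ⊥-elim (<⇒≱ c<b (m∸n≡0⇒m≤n (m+n≡0⇒n≡0 a (trans (sym noWrap) diff≡0))))
    where
    noWrap : (a + (b ∸ c)) % b ≡ a + (b ∸ c)
    noWrap = m<n⇒m%n≡m (<-≤-trans (+-monoˡ-< (b ∸ c) (≰⇒> c≰a))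
                                   (≤-reflexive (m+[n∸m]≡n (<⇒≤ c<b))))

  ominusFuel≡0⇒≡ : ∀ f {n k} → n < b ^ f → k < b ^ f → ominusFuel b f n k ≡ 0 → n ≡ k
  ominusFuel≡0⇒≡ zero n<1 k<1 _ = trans (n<1⇒n≡0 n<1) (sym (n<1⇒n≡0 k<1))
  ominusFuel≡0⇒≡ (suc f) {n} {k} n< k< ⊖≡0 = begin
    n                 ≡⟨ m≡m%n+[m/n]*n n b ⟩
    n % b + n / b * b ≡⟨ cong₂ (λ r q → r + q * b) low high ⟩
    k % b + k / b * b ≡⟨ m≡m%n+[m/n]*n k b ⟨
    k                 ∎
    where
    open ≡-Reasoning
    rest≡0 : ominusFuel b f (n / b) (k / b) ≡ 0
    rest≡0 = m*n≡0⇒m≡0 _ b (trans (*-comm _ b) (m+n≡0⇒n≡0 _ ⊖≡0))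
    low : n % b ≡ k % b
    low = digitDiff≡0⇒≡ (m%n<n n b) (m%n<n k b) (m+n≡0⇒m≡0 _ ⊖≡0)
    high : n / b ≡ k / b
    high = ominusFuel≡0⇒≡ f (m<n*o⇒m/o<n (subst (n <_) (*-comm b _) n<))
                            (m<n*o⇒m/o<n (subst (k <_) (*-comm b _) k<)) rest≡0

  ominusFuel<b^p⇒/≡ : ∀ p f {n k} → n < b ^ f → k < b ^ f →
                      ominusFuel b f n k < b ^ p → n /b^ p ≡ k /b^ p
  ominusFuel<b^p⇒/≡ zero f {n} {k} n< k< ⊖<1 =
    cong (_/b^ zero) (ominusFuel≡0⇒≡ f n< k< (n<1⇒n≡0 ⊖<1))
  ominusFuel<b^p⇒/≡ (suc p) zero n<1 k<1 _ =
    cong (_/b^ suc p) (trans (n<1⇒n≡0 n<1) (sym (n<1⇒n≡0 k<1)))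
  ominusFuel<b^p⇒/≡ (suc p) (suc f) {n} {k} n< k< ⊖< = begin
    n / (b * b ^ p)   ≡⟨ m/n/o≡m/[n*o] n b (b ^ p) ⟨
    n / b / b ^ p     ≡⟨ ominusFuel<b^p⇒/≡ p f
                           (m<n*o⇒m/o<n (subst (n <_) (*-comm b _) n<))
                           (m<n*o⇒m/o<n (subst (k <_) (*-comm b _) k<)) rest< ⟩
    k / b / b ^ p     ≡⟨ m/n/o≡m/[n*o] k b (b ^ p) ⟩
    k / (b * b ^ p)   ∎
    where
    open ≡-Reasoning
    instance
      _ = m^n≢0 b p
      _ = m^n≢0 b (suc p)
    rest< : ominusFuel b f (n / b) (k / b) < b ^ p
    rest< = *-cancelˡ-< b _ _ (≤-<-trans (m≤n+m _ _) ⊖<)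

  prefixVal< : ∀ {v} → (∀ j → v j < b) → ∀ d → prefixVal b v d < b ^ d
  prefixVal< v<b zero    = z<s
  prefixVal< {v} v<b (suc d) = begin-strict
    prefixVal b v d * b + v d <⟨ +-monoʳ-< (prefixVal b v d * b) (v<b d) ⟩
    prefixVal b v d * b + b   ≡⟨ +-comm (prefixVal b v d * b) b ⟩
    suc (prefixVal b v d) * b ≤⟨ *-monoˡ-≤ b (prefixVal< v<b d) ⟩
    b ^ d * b                 ≡⟨ *-comm (b ^ d) b ⟩
    b ^ suc d                 ∎
    where open ≤-Reasoning

  prefixVal-cong : ∀ {v w} d → (∀ r → r < d → v r ≡ w r) → prefixVal b v d ≡ prefixVal b w d
  prefixVal-cong zero    _   = refl
  prefixVal-cong (suc d) v≡w =
    cong₂ (λ p z → p * b + z) (prefixVal-cong d (λ r r<d → v≡w r (m<n⇒m<1+n r<d))) (v≡w d ≤-refl)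

  truncDig-< : ∀ {m r} (y : Point b) → r < m → truncDig m y r ≡ toℕ (digitsOf y r)
  truncDig-< {m} {r} y r<m with r <? m
  ... | yes _  = refl
  ... | no r≮m = ⊥-elim (r≮m r<m)

  truncDig<b : ∀ m (y : Point b) r → truncDig m y r < b
  truncDig<b m y r with r <? m
  ... | yes _ = toℕ<n (digitsOf y r)
  ... | no  _ = >-nonZero⁻¹ b

  module _ {s} {e : Fin s → ℕ} {x : Seq b s} (seq : Is0eSeq b e x) where

    sameBlock-sameBox⇒⊥ : ∀ {n k} → k < n → (d : Fin s → ℕ) → (∀ i → e i ∣ d i) → 0 < sumF d →
      n /b^ sumF d ≡ k /b^ sumF d →
      (∀ i r → r < d i → ominusDig (x n i) (x k i) r ≡ 0) → ⊥
    sameBlock-sameBox⇒⊥ {n} {k} k<n d e∣d 0<m sameBlock agree =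
      <-irrefl refl (≤-trans two (≤-reflexive one))
      where
      m = sumF d
      B = b ^ m
      instance _ = m^n≢0 b m
      a : Fin s → ℕ
      a i = prefixVal b (truncDig m (x n i)) (d i)
      inBoxₐ? : (l : ℕ) → Dec (InBox m (x l) d a)
      inBoxₐ? l = inBox? m (x l) d a
      one : count inBoxₐ? (n / B * B) B ≡ 1
      one = trans (seq (n / B) m 0<m d a e∣d
                    (λ i → prefixVal< (truncDig<b m (x n i)) (d i)) ≤-refl)
                  (cong (b ^_) (n∸n≡0 m))
      kInBox : InBox m (x k) d a
      kInBox i = prefixVal-cong (d i) λ r r<d →
        let r<m = <-≤-trans r<d (≤-sumF d i) in begin
          truncDig m (x k i) r       ≡⟨ truncDig-< (x k i) r<m ⟩
          toℕ (digitsOf (x k i) r)   ≡⟨ digitDiff≡0⇒≡ (toℕ<n _) (toℕ<n _) (agree i r r<d) ⟨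
          toℕ (digitsOf (x n i) r)   ≡⟨ truncDig-< (x n i) r<m ⟨
          truncDig m (x n i) r       ∎
        where open ≡-Reasoning
      two : 2 ≤ count inBoxₐ? (n / B * B) B
      two = count-≥2 inBoxₐ? B (subst (λ q → q * B ≤ k) (sym sameBlock) (proj₁ (m/n*n≤m<m/n*n+n k B)))
                     k<n (proj₂ (m/n*n≤m<m/n*n+n n B)) kInBox (λ i → refl)

  n<b^n : 2 ≤ b → ∀ n → n < b ^ n
  n<b^n _   zero    = z<s
  n<b^n 2≤b (suc n) = <-≤-trans (≤-<-trans (n<b^n 2≤b n) (m<m*n (b ^ n) b 2≤b))
                            (≤-reflexive (*-comm (b ^ n) b))
    where instance _ = m^n≢0 b n

  ominus<b^p⇒/≡ : 2 ≤ b → ∀ {p n k} → k < n → ominusℕ b n k < b ^ p → n /b^ p ≡ k /b^ p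
  ominus<b^p⇒/≡ 2≤b {p} {n} k<n =
    ominusFuel<b^p⇒/≡ p n (n<b^n 2≤b n) (<-trans k<n (n<b^n 2≤b n))

  module FirstDifferences (2≤b : 2 ≤ b) {s} {e : Fin s → ℕ} (1≤e : ∀ i → 1 ≤ e i)
           {x : Seq b s} (seq : Is0eSeq b e x)
           {n k} (k<n : k < n) {j} (⊖< : ominusℕ b n k < b ^ suc j) where

    diff : Fin s → ℕ → ℕ
    diff i = ominusDig (x n i) (x k i)

    coarseBox⇒⊥ : (d : Fin s → ℕ) → (∀ i → e i ∣ d i) → suc j ≤ sumF d →
                  ¬ (∀ i r → r < d i → diff i r ≡ 0)
    coarseBox⇒⊥ d e∣d 1+j≤m = sameBlock-sameBox⇒⊥ seq k<n d e∣d (≤-trans z<s 1+j≤m)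
      (ominus<b^p⇒/≡ 2≤b {sumF d} k<n (<-≤-trans ⊖< (^-monoʳ-≤ b 1+j≤m)))

    firstDiff : ∀ i → ∃ (FirstNonzero (diff i))
    firstDiff i = firstNonzero (diff i) c λ zeroBelowC →
      coarseBox⇒⊥ (single i c) e∣single 1+j≤Σsingle (zeroOnSingle zeroBelowC)
      where
      c = e i * suc j
      e∣single : ∀ i′ → e i′ ∣ single i c i′
      e∣single i′ with i′ ≟F i
      ... | yes refl = m∣m*n (suc j)
      ... | no  _    = e i′ ∣0
      1+j≤Σsingle : suc j ≤ sumF (single i c)
      1+j≤Σsingle = ≤-trans (m≤n*m (suc j) (e i) {{>-nonZero (1≤e i)}})
                            (subst (_≤ sumF (single i c)) (single-≡ i c) (≤-sumF (single i c) i))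
      zeroOnSingle : (∀ r → r < c → diff i r ≡ 0) → ∀ i′ r → r < single i c i′ → diff i′ r ≡ 0
      zeroOnSingle zeroBelowC i′ r r< with i′ ≟F i
      ... | yes refl = zeroBelowC r r<
      ... | no  _    = ⊥-elim (n≮0 r<)

    firstDiffPos : Fin s → ℕ
    firstDiffPos i = proj₁ (firstDiff i)

    Σfirst≤e₀+j : sumF (λ i → suc (firstDiffPos i)) ≤ sumF e + j
    Σfirst≤e₀+j = ≮⇒≥ λ e₀+j<Σ → coarseBox⇒⊥ d e∣d (1+j≤Σd e₀+j<Σ) zeroBelowD
      where
      r = firstDiffPos
      q : Fin s → ℕ
      q i = _/_ (r i) (e i) {{>-nonZero (1≤e i)}}
      d : Fin s → ℕ
      d i = q i * e i
      e∣d : ∀ i → e i ∣ d i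
      e∣d i = n∣m*n (q i)
      d≤r<d+e : ∀ i → d i ≤ r i × r i < d i + e i
      d≤r<d+e i = m/n*n≤m<m/n*n+n (r i) (e i) {{>-nonZero (1≤e i)}}
      zeroBelowD : ∀ i r′ → r′ < d i → diff i r′ ≡ 0
      zeroBelowD i r′ r′<d = proj₁ (proj₂ (firstDiff i)) r′ (<-≤-trans r′<d (proj₁ (d≤r<d+e i)))
      1+j≤Σd : sumF e + j < sumF (λ i → suc (r i)) → suc j ≤ sumF d
      1+j≤Σd e₀+j<Σ = +-cancelʳ-≤ (sumF e) (suc j) (sumF d) (begin
        suc j + sumF e                ≡⟨ cong suc (+-comm j (sumF e)) ⟩
        suc (sumF e + j)              ≤⟨ e₀+j<Σ ⟩
        sumF (λ i → suc (r i))        ≤⟨ sumF-mono-≤ (λ i → proj₂ (d≤r<d+e i)) ⟩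
        sumF (λ i → d i + e i)        ≡⟨ sumF-+ d e ⟩
        sumF d + sumF e               ∎)
        where open ≤-Reasoning

lemma2 : (b : ℕ) → .{{_ : NonZero b}} → 2 ≤ b →
    (s : ℕ) → 1 ≤ s →
    (e : Fin s → ℕ) → (∀ i → 1 ≤ e i) →
    (x : Seq b s) → Is0eSeq b e x →
    Admissible b (sumF e) x
lemma2 b 2≤b s _ e 1≤e x seq n k k<n j _ ⊖< =
  (λ i → suc (firstDiffPos i)) ,
  (λ i → firstDiffPos i , refl , proj₂ (firstDiff i)) ,
  Σfirst≤e₀+j
  where open Radix.FirstDifferences b 2≤b 1≤e seq k<n {j} ⊖<
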